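{- Let $\mathcal{R}$ be a commutative ring with identity equipped with an involutive ring automorphism $*$. Let $\mathbf{a},\mathbf{b},\mathbf{c},\mathbf{d}\in\mathcal{R}^n$ and $\mathbf{e},\mathbf{f},\mathbf{g},\mathbf{h}\in\mathcal{R}^m$. Set \begin{align*} Q&=(\mathbf{f}^*)^t\mathbf{a}+\mathbf{g}^t\mathbf{c}-\mathbf{e}^t\mathbf{b}^*+\mathbf{h}^t\mathbf{d},\\ R&=(\mathbf{f}^*)^t\mathbf{b}+(\mathbf{g}^*)^t\mathbf{d}+\mathbf{e}^t\mathbf{a}^*-(\mathbf{h}^*)^t\mathbf{c},\\ S&=(\mathbf{g}^*)^t\mathbf{a}-\mathbf{f}^t\mathbf{c}-\mathbf{h}^t\mathbf{b}-\mathbf{e}^t\mathbf{d}^*,\\ T&=\mathbf{g}^t\mathbf{b}-\mathbf{f}^t\mathbf{d}+(\mathbf{h}^*)^t\mathbf{a}+\mathbf{e}^t\mathbf{c}^*. \end{align*} Then in $\mathcal{R}[x^{\pm1},y^{\pm1}]$, \begin{align*} &\psi_Q\psi_Q^*+\psi_R\psi_R^*+\psi_S\psi_S^*+\psi_T\psi_T^*\\ &=\big(\psi_{\mathbf{a}}\psi_{\mathbf{a}}^*+\psi_{\mathbf{b}}\psi_{\mathbf{b}}^*+\psi_{\mathbf{c}}\psi_{\mathbf{c}}^*+\psi_{\mathbf{d}}\psi_{\mathbf{d}}^*\big)(x)\,\big(\psi_{\mathbf{e}}\psi_{\mathbf{e}}^*+\psi_{\mathbf{f}}\psi_{\mathbf{f}}^*+\psi_{\mathbf{g}}\psi_{\mathbf{g}}^*+\psi_{\mathbf{h}}\psi_{\mathbf{h}}^*\big)(y),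 \end{align*} where the left side is evaluated at $(x,y)$.
   Context: For $\mathbf{s}=(s_0,\dots,s_{k-1})\in\mathcal{R}^k$: $\mathbf{s}^*=(s_{k-1}^*,\dots,s_0^*)$, $\phi_{\mathbf{s}}(x)=\sum_{i=0}^{k-1}s_ix^i$, $\psi_{\mathbf{s}}(x)=x^{1-k}\phi_{\mathbf{s}}(x^2)$. Sequences are row vectors; for $\mathbf{u}\in\mathcal{R}^m$, $\mathbf{v}\in\mathcal{R}^n$, $\mathbf{u}^t\mathbf{v}$ is the $m\times n$ matrix with entries $u_iv_j$. For $A\in\mathcal{R}^{m\times n}$ with rows $\mathbf{a}_0,\dots,\mathbf{a}_{m-1}$, $\psi_A(x,y)=\sum_{i=0}^{m-1}\psi_{\mathbf{a}_i}(x)y^{2i+1-m}$. The involution $*$ is extended to $\mathcal{R}[x^{\pm1}]$ and $\mathcal{R}[x^{\pm1},y^{\pm1}]$ by applying $*$ to coefficients and sending $x\mapsto x^{ -1}$, $y\mapsto y^{ -1}$; $p^*$ denotes the image of $p$. -}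

module Defs where

open import Level using (_⊔_)
open import Algebra.Bundles using (CommutativeRing)
open import Data.Bool using (if_then_else_; _∧_)
open import Data.Fin using (Fin; toℕ)
open import Data.List as List using (List; []; _∷_; _++_; allFin; concatMap)
open import Data.Nat as ℕ using (ℕ)
open import Data.Integer as ℤ using (ℤ; +_)
open import Data.Product using (_×_; _,_)
open import Data.Vec as Vec using (Vec)
open import Relation.Nullary.Decidable using (⌊_⌋)

-- An involutive ring automorphism * of a commutative ring with identity.
-- (A ring endomorphism that is its own inverse is an automorphism.)
record Involution {r ℓ} (R : CommutativeRing r ℓ) : Set (r ⊔ ℓ) where
  open CommutativeRing R
  field
    star     : Carrier → Carrier
    star-cong : ∀ {x y} → x ≈ y → star x ≈ star y
    star-+   : ∀ x y → star (x + y) ≈ star x + star y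
    star-*   : ∀ x y → star (x * y) ≈ star x * star y
    star-1   : star 1# ≈ 1#
    star-inv : ∀ x → star (star x) ≈ x

module Laurent {r ℓ} (R : CommutativeRing r ℓ) (ι : Involution R) where
  open CommutativeRing R
  open Involution ι

  Seq : ℕ → Set r
  Seq k = Vec Carrier k

  Mat : ℕ → ℕ → Set r
  Mat m n = Vec (Vec Carrier n) m

  _ˢ* : ∀ {k} → Seq k → Seq k
  s ˢ* = Vec.reverse (Vec.map star s)

  outer : ∀ {m n} → Seq m → Seq n → Mat m n
  outer u v = Vec.map (λ ui → Vec.map (λ vj → ui * vj) v) u

  _⊞_ : ∀ {m n} → Mat m n → Mat m n → Mat m n
  _⊞_ = Vec.zipWith (Vec.zipWith _+_)

  _⊟_ : ∀ {m n} → Mat m n → Mat m n → Mat m n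
  _⊟_ = Vec.zipWith (Vec.zipWith _-_)

  infixl 6 _⊞_ _⊟_

  -- Elements of R[x^{±1}, y^{±1}] represented as formal finite sums of
  -- monomials c x^i y^j (triples (c , i , j)); two formal sums are equal
  -- as Laurent polynomials iff all their coefficients agree.
  Poly : Set r
  Poly = List (Carrier × ℤ × ℤ)

  coeff : Poly → ℤ → ℤ → Carrier
  coeff [] i j = 0#
  coeff ((c , i' , j') ∷ p) i j =
    if ⌊ i' ℤ.≟ i ⌋ ∧ ⌊ j' ℤ.≟ j ⌋ then c + coeff p i j else coeff p i j

  _≋_ : Poly → Poly → Set ℓ
  p ≋ q = ∀ i j → coeff p i j ≈ coeff q i j

  _⊕_ : Poly → Poly → Poly
  _⊕_ = _++_

  _⊗_ : Poly → Poly → Poly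
  p ⊗ q = concatMap (λ { (c , i , j) →
            List.map (λ { (d , k , l) → (c * d , i ℤ.+ k , j ℤ.+ l) }) q }) p

  infixl 6 _⊕_
  infixl 7 _⊗_
  infix 4 _≋_

  conj : Poly → Poly
  conj = List.map (λ { (c , i , j) → (star c , ℤ.- i , ℤ.- j) })

  ex : (k : ℕ) → Fin k → ℤ
  ex k i = + (2 ℕ.* toℕ i ℕ.+ 1) ℤ.- + k

  -- ψ_s(x) = x^{1-k} φ_s(x^2) = Σ_i s_i x^{2i+1-k}, as a polynomial in x (y-degree 0)
  ψx : ∀ {k} → Seq k → Poly
  ψx {k} s = List.map (λ i → (Vec.lookup s i , ex k i , + 0)) (allFin k)

  ψy : ∀ {k} → Seq k → Poly
  ψy {k} s = List.map (λ i → (Vec.lookup s i , + 0 , ex k i)) (allFin k)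

  ψM : ∀ {m n} → Mat m n → Poly
  ψM {m} {n} A = concatMap (λ i →
      List.map (λ j → (Vec.lookup (Vec.lookup A i) j , ex n j , ex m i)) (allFin n))
    (allFin m)

module Submission where

-- The identity is a consequence of one polynomial identity in an arbitrary
-- commutative ring K with an involution ⋆ (norm-identity below): for A, …, H ∈ K,
--   Q Q⋆ + R R⋆ + S S⋆ + T T⋆ = (A A⋆ + … + D D⋆)(E E⋆ + … + H H⋆)
-- with Q = F⋆A + GC − EB⋆ + HD etc.  Treating A⋆, …, H⋆ as independent variables
-- it is an identity of commutative rings (quaternion-identity), proved with the
-- semiring solver after separating every factor into positive and negative parts.
--
-- The theorem is this identity in K = R[x^{±1}, y^{±1}] with ⋆ = conj, applied to
-- A = ψ_a(x), …, E = ψ_e(y), ….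
-- Then ψ_Q = F⋆A + GC − EB⋆ + HD, and likewise for R, S, T, and norm-identity applies.

open import Defs
open import Algebra.Bundles using (CommutativeRing)
open import Data.Bool using (Bool; true; false; if_then_else_; _∧_)
open import Data.Fin using (Fin; zero; suc; toℕ; opposite; fromℕ; inject₁)
import Data.Fin.Properties as FinP
open import Data.Fin.Permutation using (reverse)
open import Data.Integer as ℤ using (ℤ; +_)
import Data.Integer.Properties as ℤP
open import Data.Integer.Tactic.RingSolver using (solve-∀)
open import Data.List as List using (List; []; _∷_; _++_; allFin; concatMap; tabulate)
open import Data.Nat as ℕ using (ℕ)
import Data.Nat.Properties as NatP
import Data.Nat.Tactic.RingSolver as NatSolver
open import Data.Product using (_×_; _,_)
open import Data.Vec as Vec using (Vec)
import Data.Vec.Properties as VecP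
open import Function using (_∘_; id; _⇔_; mk⇔)
open import Relation.Nullary.Decidable using (⌊_⌋; does-⇔; isYes≗does)
open import Relation.Binary.PropositionalEquality as ≡ using (_≡_)

module InvolutionProperties {r ℓ} (R : CommutativeRing r ℓ) (ι : Involution R) where
  open CommutativeRing R
  open Involution ι
  open import Algebra.Properties.Ring ring using (x+x≈x⇒x≈0)
  open import Algebra.Properties.Group +-group using (inverseˡ-unique)

  star-0 : star 0# ≈ 0#
  star-0 = x+x≈x⇒x≈0 (star 0#) (trans (sym (star-+ 0# 0#)) (star-cong (+-identityˡ 0#)))

  star-neg : ∀ x → star (- x) ≈ - star x
  star-neg x = inverseˡ-unique (star (- x)) (star x)
    (trans (sym (star-+ (- x) x)) (trans (star-cong (-‿inverseˡ x)) star-0))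

  star-− : ∀ x y → star (x - y) ≈ star x - star y
  star-− x y = trans (star-+ x (- y)) (+-congˡ (star-neg y))

module RingIdentities {r ℓ} (K : CommutativeRing r ℓ) where
  open CommutativeRing K
  open import Algebra.Solver.Ring.NaturalCoefficients.Default commutativeSemiring
  open import Relation.Binary.Reasoning.Setoid setoid
  open import Algebra.Properties.Ring ring using (-‿distribˡ-*; -‿distribʳ-*)
  open import Algebra.Properties.AbelianGroup +-abelianGroup using (⁻¹-∙-comm)
  open import Algebra.Properties.Group +-group using (⁻¹-involutive; ∙-cancelʳ)

  -- The natural-coefficient solver cannot cancel x against - x, so it is used with
  -- negated quantities as atoms and the cancellations are made explicitly.

  difference-product : ∀ p n p′ n′ →
    (p - n) * (p′ - n′) + (p * n′ + n * p′) ≈ p * p′ + n * n′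
  difference-product p n p′ n′ = begin
    (p - n) * (p′ - n′) + (p * n′ + n * p′)
      ≈⟨ solve 6 (λ p m p′ m′ n n′ → (p :+ m) :* (p′ :+ m′) :+ (p :* n′ :+ n :* p′)
                   := (p :* p′ :+ m :* m′) :+ ((p :* m′ :+ p :* n′) :+ (m :* p′ :+ n :* p′)))
                 refl p (- n) p′ (- n′) n n′ ⟩
    (p * p′ + - n * - n′) + ((p * - n′ + p * n′) + (- n * p′ + n * p′))
      ≈⟨ +-cong (+-congˡ neg-neg) (+-cong (cancelˡ p n′) (cancelʳ n p′)) ⟩
    (p * p′ + n * n′) + (0# + 0#)
      ≈⟨ trans (+-congˡ (+-identityˡ 0#)) (+-identityʳ _) ⟩
    p * p′ + n * n′ ∎
    where
    neg-neg : - n * - n′ ≈ n * n′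
    neg-neg = trans (sym (-‿distribˡ-* n (- n′)))
                (trans (-‿cong (sym (-‿distribʳ-* n n′))) (⁻¹-involutive (n * n′)))
    cancelˡ : ∀ x y → x * - y + x * y ≈ 0#
    cancelˡ x y = trans (sym (distribˡ x (- y) y)) (trans (*-congˡ (-‿inverseˡ y)) (zeroʳ x))
    cancelʳ : ∀ x y → - x * y + x * y ≈ 0#
    cancelʳ x y = trans (sym (distribʳ y (- x) x)) (trans (*-congʳ (-‿inverseˡ x)) (zeroˡ y))

  subtract-last₃ : ∀ a b c d → a + b - c + d ≈ a + b + d - c
  subtract-last₃ a b c d = solve 4 (λ a b m d → a :+ b :+ m :+ d := a :+ b :+ d :+ m) refl a b (- c) d

  subtract-last₂ : ∀ a b c d → a - b + c + d ≈ a + c + d - b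
  subtract-last₂ a b c d = solve 4 (λ a m c d → a :+ m :+ c :+ d := a :+ c :+ d :+ m) refl a (- b) c d

  subtract-all : ∀ a b c d → a - b - c - d ≈ a - (b + c + d)
  subtract-all a b c d = begin
    a - b - c - d
      ≈⟨ solve 4 (λ a x y z → a :+ x :+ y :+ z := a :+ (x :+ y :+ z)) refl a (- b) (- c) (- d) ⟩
    a + (- b + - c + - d)
      ≈⟨ +-congˡ (trans (+-congʳ (⁻¹-∙-comm b c)) (⁻¹-∙-comm (b + c) d)) ⟩
    a - (b + c + d) ∎

  cancel-four : ∀ x₁ x₂ x₃ x₄ w₁ w₂ w₃ w₄ u₁ u₂ u₃ u₄ X →
    x₁ + w₁ ≈ u₁ → x₂ + w₂ ≈ u₂ → x₃ + w₃ ≈ u₃ → x₄ + w₄ ≈ u₄ →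
    u₁ + u₂ + u₃ + u₄ ≈ X + (w₁ + w₂ + w₃ + w₄) →
    x₁ + x₂ + x₃ + x₄ ≈ X
  cancel-four x₁ x₂ x₃ x₄ w₁ w₂ w₃ w₄ u₁ u₂ u₃ u₄ X e₁ e₂ e₃ e₄ e =
    ∙-cancelʳ (w₁ + w₂ + w₃ + w₄) _ _ (begin
      x₁ + x₂ + x₃ + x₄ + (w₁ + w₂ + w₃ + w₄)
        ≈⟨ solve 8 (λ x₁ x₂ x₃ x₄ w₁ w₂ w₃ w₄ →
             x₁ :+ x₂ :+ x₃ :+ x₄ :+ (w₁ :+ w₂ :+ w₃ :+ w₄)
             := (x₁ :+ w₁) :+ (x₂ :+ w₂) :+ (x₃ :+ w₃) :+ (x₄ :+ w₄)) refl x₁ x₂ x₃ x₄ w₁ w₂ w₃ w₄ ⟩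
      (x₁ + w₁) + (x₂ + w₂) + (x₃ + w₃) + (x₄ + w₄)
        ≈⟨ +-cong (+-cong (+-cong e₁ e₂) e₃) e₄ ⟩
      u₁ + u₂ + u₃ + u₄
        ≈⟨ e ⟩
      X + (w₁ + w₂ + w₃ + w₄) ∎)

  -- The subtraction-free core of the identity below: with each signed sum qₖ split
  -- as pₖ - nₖ, the products pₖpₖ′ + nₖnₖ′ add up to the product of the two norms
  -- plus the cross terms pₖnₖ′ + nₖpₖ′ (a polynomial identity with natural coefficients).
  split-identity : ∀ A A′ B B′ C C′ D D′ E E′ F F′ G G′ H H′ →
    ((F′ * A + G * C + H * D) * (F * A′ + G′ * C′ + H′ * D′) + (E * B′) * (E′ * B))
    + ((F′ * B + G′ * D + E * A′) * (F * B′ + G * D′ + E′ * A) + (H′ * C) * (H * C′))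
    + ((G′ * A) * (G * A′) + (F * C + H * B + E * D′) * (F′ * C′ + H′ * B′ + E′ * D))
    + ((G * B + H′ * A + E * C′) * (G′ * B′ + H * A′ + E′ * C) + (F * D) * (F′ * D′))
    ≈ (A * A′ + B * B′ + C * C′ + D * D′) * (E * E′ + F * F′ + G * G′ + H * H′)
    + (((F′ * A + G * C + H * D) * (E′ * B) + (E * B′) * (F * A′ + G′ * C′ + H′ * D′))
    + ((F′ * B + G′ * D + E * A′) * (H * C′) + (H′ * C) * (F * B′ + G * D′ + E′ * A))
    + ((G′ * A) * (F′ * C′ + H′ * B′ + E′ * D) + (F * C + H * B + E * D′) * (G * A′))
    + ((G * B + H′ * A + E * C′) * (F′ * D′) + (F * D) * (G′ * B′ + H * A′ + E′ * C)))
  split-identity = solve 16 (λ A A′ B B′ C C′ D D′ E E′ F F′ G G′ H H′ →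
    ((F′ :* A :+ G :* C :+ H :* D) :* (F :* A′ :+ G′ :* C′ :+ H′ :* D′) :+ (E :* B′) :* (E′ :* B))
    :+ ((F′ :* B :+ G′ :* D :+ E :* A′) :* (F :* B′ :+ G :* D′ :+ E′ :* A) :+ (H′ :* C) :* (H :* C′))
    :+ ((G′ :* A) :* (G :* A′) :+ (F :* C :+ H :* B :+ E :* D′) :* (F′ :* C′ :+ H′ :* B′ :+ E′ :* D))
    :+ ((G :* B :+ H′ :* A :+ E :* C′) :* (G′ :* B′ :+ H :* A′ :+ E′ :* C) :+ (F :* D) :* (F′ :* D′))
    := (A :* A′ :+ B :* B′ :+ C :* C′ :+ D :* D′) :* (E :* E′ :+ F :* F′ :+ G :* G′ :+ H :* H′)
    :+ (((F′ :* A :+ G :* C :+ H :* D) :* (E′ :* B) :+ (E :* B′) :* (F :* A′ :+ G′ :* C′ :+ H′ :* D′))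
    :+ ((F′ :* B :+ G′ :* D :+ E :* A′) :* (H :* C′) :+ (H′ :* C) :* (F :* B′ :+ G :* D′ :+ E′ :* A))
    :+ ((G′ :* A) :* (F′ :* C′ :+ H′ :* B′ :+ E′ :* D) :+ (F :* C :+ H :* B :+ E :* D′) :* (G :* A′))
    :+ ((G :* B :+ H′ :* A :+ E :* C′) :* (F′ :* D′) :+ (F :* D) :* (G′ :* B′ :+ H :* A′ :+ E′ :* C)))) refl

  quaternion-identity : ∀ A A′ B B′ C C′ D D′ E E′ F F′ G G′ H H′ →
    (F′ * A + G * C - E * B′ + H * D) * (F * A′ + G′ * C′ - E′ * B + H′ * D′)
    + (F′ * B + G′ * D + E * A′ - H′ * C) * (F * B′ + G * D′ + E′ * A - H * C′)
    + (G′ * A - F * C - H * B - E * D′) * (G * A′ - F′ * C′ - H′ * B′ - E′ * D)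
    + (G * B - F * D + H′ * A + E * C′) * (G′ * B′ - F′ * D′ + H * A′ + E′ * C)
    ≈ (A * A′ + B * B′ + C * C′ + D * D′) * (E * E′ + F * F′ + G * G′ + H * H′)
  quaternion-identity A A′ B B′ C C′ D D′ E E′ F F′ G G′ H H′ =
    cancel-four _ _ _ _ _ _ _ _ _ _ _ _ _
      (trans (+-congʳ (*-cong (subtract-last₃ _ _ _ _) (subtract-last₃ _ _ _ _))) (difference-product _ _ _ _))
      (difference-product _ _ _ _)
      (trans (+-congʳ (*-cong (subtract-all _ _ _ _) (subtract-all _ _ _ _))) (difference-product _ _ _ _))
      (trans (+-congʳ (*-cong (subtract-last₂ _ _ _ _) (subtract-last₂ _ _ _ _))) (difference-product _ _ _ _))
      (split-identity A A′ B B′ C C′ D D′ E E′ F F′ G G′ H H′)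

module NormIdentity {r ℓ} (K : CommutativeRing r ℓ) (κ : Involution K) where
  open CommutativeRing K
  open Involution κ
  open InvolutionProperties K κ using (star-−)
  open RingIdentities K using (quaternion-identity)

  infixl 6 _+⋆_ _-⋆_

  _+⋆_ : ∀ {x y x′ y′} → star x ≈ x′ → star y ≈ y′ → star (x + y) ≈ x′ + y′
  e₁ +⋆ e₂ = trans (star-+ _ _) (+-cong e₁ e₂)

  _-⋆_ : ∀ {x y x′ y′} → star x ≈ x′ → star y ≈ y′ → star (x - y) ≈ x′ - y′
  e₁ -⋆ e₂ = trans (star-− _ _) (+-cong e₁ (-‿cong e₂))

  star-⋆* : ∀ x y → star (star x * y) ≈ x * star y
  star-⋆* x y = trans (star-* _ _) (*-congʳ (star-inv x))

  star-*⋆ : ∀ x y → star (x * star y) ≈ star x * y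
  star-*⋆ x y = trans (star-* _ _) (*-congˡ (star-inv y))

  -- Conjugating Q, R, S, T termwise turns them into the primed factors of
  -- quaternion-identity with A′ = A⋆, …, H′ = H⋆.
  norm-identity : ∀ A B C D E F G H →
    let Q = star F * A + G * C - E * star B + H * D
        R = star F * B + star G * D + E * star A - star H * C
        S = star G * A - F * C - H * B - E * star D
        T = G * B - F * D + star H * A + E * star C
    in Q * star Q + R * star R + S * star S + T * star T
       ≈ (A * star A + B * star B + C * star C + D * star D)
         * (E * star E + F * star F + G * star G + H * star H)
  norm-identity A B C D E F G H = trans
    (+-cong (+-cong (+-cong (*-congˡ star-Q) (*-congˡ star-R)) (*-congˡ star-S)) (*-congˡ star-T))
    (quaternion-identity A (star A) B (star B) C (star C) D (star D)
                         E (star E) F (star F) G (star G) H (star H))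
    where
    star-Q : star (star F * A + G * C - E * star B + H * D)
             ≈ F * star A + star G * star C - star E * B + star H * star D
    star-Q = star-⋆* F A +⋆ star-* G C -⋆ star-*⋆ E B +⋆ star-* H D
    star-R : star (star F * B + star G * D + E * star A - star H * C)
             ≈ F * star B + G * star D + star E * A - H * star C
    star-R = star-⋆* F B +⋆ star-⋆* G D +⋆ star-*⋆ E A -⋆ star-⋆* H C
    star-S : star (star G * A - F * C - H * B - E * star D)
             ≈ G * star A - star F * star C - star H * star B - star E * D
    star-S = star-⋆* G A -⋆ star-* F C -⋆ star-* H B -⋆ star-*⋆ E D
    star-T : star (G * B - F * D + star H * A + E * star C)
             ≈ star G * star B - star F * star D + H * star A + star E * C
    star-T = star-* G B -⋆ star-* F D +⋆ star-⋆* H A +⋆ star-*⋆ E C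

module _ {a} {A : Set a} where
  lookup-∷ʳ-last : ∀ {n} (xs : Vec A n) x → Vec.lookup (xs Vec.∷ʳ x) (fromℕ n) ≡ x
  lookup-∷ʳ-last Vec.[] x = ≡.refl
  lookup-∷ʳ-last (y Vec.∷ xs) x = lookup-∷ʳ-last xs x

  lookup-∷ʳ-inject₁ : ∀ {n} (xs : Vec A n) x k → Vec.lookup (xs Vec.∷ʳ x) (inject₁ k) ≡ Vec.lookup xs k
  lookup-∷ʳ-inject₁ (y Vec.∷ xs) x zero = ≡.refl
  lookup-∷ʳ-inject₁ (y Vec.∷ xs) x (suc k) = lookup-∷ʳ-inject₁ xs x k

  lookup-reverse-opposite : ∀ {n} (xs : Vec A n) i → Vec.lookup (Vec.reverse xs) (opposite i) ≡ Vec.lookup xs i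
  lookup-reverse-opposite (x Vec.∷ xs) zero rewrite VecP.reverse-∷ x xs = lookup-∷ʳ-last (Vec.reverse xs) x
  lookup-reverse-opposite (x Vec.∷ xs) (suc i) rewrite VecP.reverse-∷ x xs =
    ≡.trans (lookup-∷ʳ-inject₁ (Vec.reverse xs) x (opposite i)) (lookup-reverse-opposite xs i)

  lookup-reverse : ∀ {n} (xs : Vec A n) i → Vec.lookup (Vec.reverse xs) i ≡ Vec.lookup xs (opposite i)
  lookup-reverse xs i = ≡.trans (≡.cong (Vec.lookup (Vec.reverse xs)) (≡.sym (FinP.opposite-involutive i)))
                                (lookup-reverse-opposite xs (opposite i))

shift-⇔ : ∀ i′ k i → (i′ ℤ.+ k ≡ i) ⇔ (k ≡ i ℤ.- i′)
shift-⇔ i′ k i = mk⇔ (λ { ≡.refl → cancel i′ k }) (λ { ≡.refl → uncancel i′ i })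
  where
  cancel : ∀ a b → b ≡ (a ℤ.+ b) ℤ.- a
  cancel = solve-∀
  uncancel : ∀ a b → a ℤ.+ (b ℤ.- a) ≡ b
  uncancel = solve-∀

negate-⇔ : ∀ i′ i → (ℤ.- i′ ≡ i) ⇔ (i′ ≡ ℤ.- i)
negate-⇔ i′ i = mk⇔ (λ { ≡.refl → ≡.sym (ℤP.neg-involutive i′) }) (λ { ≡.refl → ℤP.neg-involutive i })

reflect-about : ∀ a b k → a ℤ.+ b ≡ k ℤ.+ k → a ℤ.- k ≡ ℤ.- (b ℤ.- k)
reflect-about a b k a+b≡2k = begin
  a ℤ.- k                                         ≡⟨ expand a b k ⟩
  ((a ℤ.+ b) ℤ.- (k ℤ.+ k)) ℤ.+ ℤ.- (b ℤ.- k)     ≡⟨ ≡.cong (λ z → (z ℤ.- (k ℤ.+ k)) ℤ.+ ℤ.- (b ℤ.- k)) a+b≡2k ⟩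
  ((k ℤ.+ k) ℤ.- (k ℤ.+ k)) ℤ.+ ℤ.- (b ℤ.- k)     ≡⟨ collapse b k ⟩
  ℤ.- (b ℤ.- k)                                   ∎
  where
  open ≡.≡-Reasoning
  expand : ∀ a b k → a ℤ.- k ≡ ((a ℤ.+ b) ℤ.- (k ℤ.+ k)) ℤ.+ ℤ.- (b ℤ.- k)
  expand = solve-∀
  collapse : ∀ b k → ((k ℤ.+ k) ℤ.- (k ℤ.+ k)) ℤ.+ ℤ.- (b ℤ.- k) ≡ ℤ.- (b ℤ.- k)
  collapse = solve-∀

≟-⇔ : ∀ {a b c d : ℤ} → (a ≡ b) ⇔ (c ≡ d) → ⌊ a ℤ.≟ b ⌋ ≡ ⌊ c ℤ.≟ d ⌋
≟-⇔ e = ≡.trans (isYes≗does (_ ℤ.≟ _))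
          (≡.trans (does-⇔ e (_ ℤ.≟ _) (_ ℤ.≟ _)) (≡.sym (isYes≗does (_ ℤ.≟ _))))

-- R[x^{±1}, y^{±1}] as formal sums of monomials modulo equality of all coefficients:
-- coefficients are computed monomial by monomial as finite sums, from which the
-- commutative-ring axioms and the involution laws of conj follow.
module LaurentRing {r ℓ} (R : CommutativeRing r ℓ) (ι : Involution R) where
  open CommutativeRing R
  open Involution ι
  open Laurent R ι
  open InvolutionProperties R ι using (star-0)
  open import Relation.Binary.Reasoning.Setoid setoid
  open import Algebra.Properties.CommutativeSemigroup +-commutativeSemigroup using (interchange)
  open import Algebra.Properties.AbelianGroup +-abelianGroup using (⁻¹-∙-comm)
  open import Algebra.Properties.Group +-group using (ε⁻¹≈ε)
  open import Algebra.Properties.CommutativeMonoid.Sum +-commutativeMonoid using (sum; sum-permute)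

  ∑ : ∀ {a} {A : Set a} → List A → (A → Carrier) → Carrier
  ∑ [] F = 0#
  ∑ (x ∷ xs) F = F x + ∑ xs F

  module _ {a} {A : Set a} where
    ∑-cong : ∀ (xs : List A) {F G : A → Carrier} → (∀ x → F x ≈ G x) → ∑ xs F ≈ ∑ xs G
    ∑-cong [] eq = refl
    ∑-cong (x ∷ xs) eq = +-cong (eq x) (∑-cong xs eq)

    ∑-++ : ∀ (xs ys : List A) (F : A → Carrier) → ∑ (xs ++ ys) F ≈ ∑ xs F + ∑ ys F
    ∑-++ [] ys F = sym (+-identityˡ _)
    ∑-++ (x ∷ xs) ys F = trans (+-congˡ (∑-++ xs ys F)) (sym (+-assoc _ _ _))

    ∑-+ : ∀ (xs : List A) (F G : A → Carrier) → ∑ xs (λ x → F x + G x) ≈ ∑ xs F + ∑ xs G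
    ∑-+ [] F G = sym (+-identityˡ _)
    ∑-+ (x ∷ xs) F G = trans (+-congˡ (∑-+ xs F G)) (interchange _ _ _ _)

    ∑-0 : ∀ (xs : List A) → ∑ xs (λ _ → 0#) ≈ 0#
    ∑-0 [] = refl
    ∑-0 (x ∷ xs) = trans (+-identityˡ _) (∑-0 xs)

    ∑-neg : ∀ (xs : List A) (F : A → Carrier) → ∑ xs (λ x → - F x) ≈ - ∑ xs F
    ∑-neg [] F = sym ε⁻¹≈ε
    ∑-neg (x ∷ xs) F = trans (+-congˡ (∑-neg xs F)) (⁻¹-∙-comm _ _)

    ∑-*ˡ : ∀ c (xs : List A) (F : A → Carrier) → c * ∑ xs F ≈ ∑ xs (λ x → c * F x)
    ∑-*ˡ c [] F = zeroʳ c
    ∑-*ˡ c (x ∷ xs) F = trans (distribˡ c _ _) (+-congˡ (∑-*ˡ c xs F))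

    ∑-star : ∀ (xs : List A) (F : A → Carrier) → star (∑ xs F) ≈ ∑ xs (λ x → star (F x))
    ∑-star [] F = star-0
    ∑-star (x ∷ xs) F = trans (star-+ _ _) (+-congˡ (∑-star xs F))

  ∑-swap : ∀ {a b} {A : Set a} {B : Set b} (xs : List A) (ys : List B) (F : A → B → Carrier) →
           ∑ xs (λ x → ∑ ys (F x)) ≈ ∑ ys (λ y → ∑ xs (λ x → F x y))
  ∑-swap [] ys F = sym (∑-0 ys)
  ∑-swap (x ∷ xs) ys F = trans (+-congˡ (∑-swap xs ys F)) (sym (∑-+ ys (F x) _))

  ∑-map : ∀ {a b} {A : Set a} {B : Set b} (h : A → B) (xs : List A) (F : B → Carrier) →
          ∑ (List.map h xs) F ≈ ∑ xs (F ∘ h)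
  ∑-map h [] F = refl
  ∑-map h (x ∷ xs) F = +-congˡ (∑-map h xs F)

  ∑-concatMap : ∀ {a b} {A : Set a} {B : Set b} (f : A → List B) (xs : List A) (F : B → Carrier) →
                ∑ (concatMap f xs) F ≈ ∑ xs (λ x → ∑ (f x) F)
  ∑-concatMap f [] F = refl
  ∑-concatMap f (x ∷ xs) F = trans (∑-++ (f x) (concatMap f xs) F) (+-congˡ (∑-concatMap f xs F))

  ∑-tabulate : ∀ {a} {A : Set a} k (g : Fin k → A) (F : A → Carrier) → ∑ (tabulate g) F ≈ sum (F ∘ g)
  ∑-tabulate ℕ.zero g F = refl
  ∑-tabulate (ℕ.suc k) g F = +-congˡ (∑-tabulate k (g ∘ suc) F)

  ∑-opposite : ∀ k (F : Fin k → Carrier) → ∑ (allFin k) (F ∘ opposite) ≈ ∑ (allFin k) F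
  ∑-opposite k F = begin
    ∑ (allFin k) (F ∘ opposite) ≈⟨ ∑-tabulate k id (F ∘ opposite) ⟩
    sum (F ∘ opposite)          ≈⟨ sum-permute F reverse ⟨
    sum F                       ≈⟨ ∑-tabulate k id F ⟨
    ∑ (allFin k) F              ∎

  Monomial : Set r
  Monomial = Carrier × ℤ × ℤ

  select : Bool → Carrier → Carrier
  select b c = if b then c else 0#

  monoCoeff : ℤ → ℤ → Monomial → Carrier
  monoCoeff i j (c , i′ , j′) = select (⌊ i′ ℤ.≟ i ⌋ ∧ ⌊ j′ ℤ.≟ j ⌋) c

  coeff≈∑ : ∀ p i j → coeff p i j ≈ ∑ p (monoCoeff i j)
  coeff≈∑ [] i j = refl
  coeff≈∑ ((c , i′ , j′) ∷ p) i j with ⌊ i′ ℤ.≟ i ⌋ ∧ ⌊ j′ ℤ.≟ j ⌋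
  ... | true  = +-congˡ (coeff≈∑ p i j)
  ... | false = trans (coeff≈∑ p i j) (sym (+-identityˡ _))

  select-cong : ∀ b {c d} → c ≈ d → select b c ≈ select b d
  select-cong true  e = e
  select-cong false e = refl

  select-*ˡ : ∀ b c d → select b (c * d) ≈ c * select b d
  select-*ˡ true  c d = refl
  select-*ˡ false c d = sym (zeroʳ c)

  select-+ : ∀ b c d → select b (c + d) ≈ select b c + select b d
  select-+ true  c d = refl
  select-+ false c d = sym (+-identityˡ 0#)

  select-neg : ∀ b c → select b (- c) ≈ - select b c
  select-neg true  c = refl
  select-neg false c = sym ε⁻¹≈ε

  select-star : ∀ b c → select b (star c) ≈ star (select b c)
  select-star true  c = refl
  select-star false c = sym star-0

  infix 4 _∼_

  _∼_ : Monomial → Monomial → Set ℓ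
  (c , i , j) ∼ (d , k , l) = (c ≈ d) × (i ≡ k) × (j ≡ l)

  ∼-sym : ∀ {m n} → m ∼ n → n ∼ m
  ∼-sym {_ , _ , _} {_ , _ , _} (e , f , g) = sym e , ≡.sym f , ≡.sym g

  monoCoeff-cong : ∀ i j {m n} → m ∼ n → monoCoeff i j m ≈ monoCoeff i j n
  monoCoeff-cong i j {c , i′ , j′} {d , .i′ , .j′} (e , ≡.refl , ≡.refl) = select-cong _ e

  infixl 7 _·_

  _·_ : Monomial → Monomial → Monomial
  (c , i , j) · (d , k , l) = (c * d , i ℤ.+ k , j ℤ.+ l)

  negMono : Monomial → Monomial
  negMono (c , i , j) = (- c , i , j)

  conjMono : Monomial → Monomial
  conjMono (c , i , j) = (star c , ℤ.- i , ℤ.- j)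

  ·-comm : ∀ m n → m · n ∼ n · m
  ·-comm (c , i , j) (d , k , l) = *-comm c d , ℤP.+-comm i k , ℤP.+-comm j l

  ·-assoc : ∀ m n o → (m · n) · o ∼ m · (n · o)
  ·-assoc (c , i , j) (d , k , l) (e , u , v) = *-assoc c d e , ℤP.+-assoc i k u , ℤP.+-assoc j l v

  ·-identityˡ : ∀ n → (1# , + 0 , + 0) · n ∼ n
  ·-identityˡ (d , k , l) = *-identityˡ d , ℤP.+-identityˡ k , ℤP.+-identityˡ l

  conj-· : ∀ m n → conjMono m · conjMono n ∼ conjMono (m · n)
  conj-· (c , i , j) (d , k , l) =
    sym (star-* c d) , ≡.sym (ℤP.neg-distrib-+ i k) , ≡.sym (ℤP.neg-distrib-+ j l)

  monoCoeff-· : ∀ i j c k l n →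
    monoCoeff i j ((c , k , l) · n) ≈ c * monoCoeff (i ℤ.- k) (j ℤ.- l) n
  monoCoeff-· i j c k l (d , k′ , l′) = begin
    select (⌊ k ℤ.+ k′ ℤ.≟ i ⌋ ∧ ⌊ l ℤ.+ l′ ℤ.≟ j ⌋) (c * d)
      ≡⟨ ≡.cong (λ b → select b (c * d))
           (≡.cong₂ _∧_ (≟-⇔ (shift-⇔ k k′ i)) (≟-⇔ (shift-⇔ l l′ j))) ⟩
    select (⌊ k′ ℤ.≟ i ℤ.- k ⌋ ∧ ⌊ l′ ℤ.≟ j ℤ.- l ⌋) (c * d)
      ≈⟨ select-*ˡ _ c d ⟩
    c * monoCoeff (i ℤ.- k) (j ℤ.- l) (d , k′ , l′) ∎

  monoCoeff-neg : ∀ i j m → monoCoeff i j (negMono m) ≈ - monoCoeff i j m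
  monoCoeff-neg i j (c , i′ , j′) = select-neg _ c

  monoCoeff-conj : ∀ i j m → monoCoeff i j (conjMono m) ≈ star (monoCoeff (ℤ.- i) (ℤ.- j) m)
  monoCoeff-conj i j (c , i′ , j′) = begin
    select (⌊ ℤ.- i′ ℤ.≟ i ⌋ ∧ ⌊ ℤ.- j′ ℤ.≟ j ⌋) (star c)
      ≡⟨ ≡.cong (λ b → select b (star c))
           (≡.cong₂ _∧_ (≟-⇔ (negate-⇔ i′ i)) (≟-⇔ (negate-⇔ j′ j))) ⟩
    select (⌊ i′ ℤ.≟ ℤ.- i ⌋ ∧ ⌊ j′ ℤ.≟ ℤ.- j ⌋) (star c)
      ≈⟨ select-star _ c ⟩
    star (monoCoeff (ℤ.- i) (ℤ.- j) (c , i′ , j′)) ∎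

  negate : Poly → Poly
  negate = List.map negMono

  one : Poly
  one = (1# , + 0 , + 0) ∷ []

  coeff-⊕ : ∀ p q i j → coeff (p ⊕ q) i j ≈ coeff p i j + coeff q i j
  coeff-⊕ p q i j = begin
    coeff (p ⊕ q) i j                           ≈⟨ coeff≈∑ (p ⊕ q) i j ⟩
    ∑ (p ⊕ q) (monoCoeff i j)                   ≈⟨ ∑-++ p q _ ⟩
    ∑ p (monoCoeff i j) + ∑ q (monoCoeff i j)   ≈⟨ +-cong (coeff≈∑ p i j) (coeff≈∑ q i j) ⟨
    coeff p i j + coeff q i j                   ∎

  coeff-negate : ∀ p i j → coeff (negate p) i j ≈ - coeff p i j
  coeff-negate p i j = begin
    coeff (negate p) i j               ≈⟨ coeff≈∑ (negate p) i j ⟩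
    ∑ (negate p) (monoCoeff i j)       ≈⟨ ∑-map negMono p _ ⟩
    ∑ p (monoCoeff i j ∘ negMono)      ≈⟨ ∑-cong p (monoCoeff-neg i j) ⟩
    ∑ p (λ m → - monoCoeff i j m)      ≈⟨ ∑-neg p _ ⟩
    - ∑ p (monoCoeff i j)              ≈⟨ -‿cong (coeff≈∑ p i j) ⟨
    - coeff p i j                      ∎

  coeff-⊗ : ∀ p q i j → coeff (p ⊗ q) i j ≈ ∑ p (λ m → ∑ q (λ n → monoCoeff i j (m · n)))
  coeff-⊗ p q i j =
    trans (coeff≈∑ (p ⊗ q) i j) (trans (∑-concatMap _ p _) (∑-cong p (λ m → ∑-map _ q _)))

  shifted : Poly → ℤ → ℤ → Monomial → Carrier
  shifted q i j (c , k , l) = c * coeff q (i ℤ.- k) (j ℤ.- l)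

  coeff-⊗-shifted : ∀ p q i j → coeff (p ⊗ q) i j ≈ ∑ p (shifted q i j)
  coeff-⊗-shifted p q i j = trans (coeff-⊗ p q i j) (∑-cong p contribution)
    where
    contribution : ∀ m → ∑ q (λ n → monoCoeff i j (m · n)) ≈ shifted q i j m
    contribution (c , k , l) = begin
      ∑ q (λ n → monoCoeff i j ((c , k , l) · n))
        ≈⟨ ∑-cong q (monoCoeff-· i j c k l) ⟩
      ∑ q (λ n → c * monoCoeff (i ℤ.- k) (j ℤ.- l) n)
        ≈⟨ ∑-*ˡ c q _ ⟨
      c * ∑ q (monoCoeff (i ℤ.- k) (j ℤ.- l))
        ≈⟨ *-congˡ (coeff≈∑ q _ _) ⟨
      c * coeff q (i ℤ.- k) (j ℤ.- l) ∎

  coeff-conj : ∀ p i j → coeff (conj p) i j ≈ star (coeff p (ℤ.- i) (ℤ.- j))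
  coeff-conj p i j = begin
    coeff (conj p) i j                              ≈⟨ coeff≈∑ (conj p) i j ⟩
    ∑ (conj p) (monoCoeff i j)                      ≈⟨ ∑-map conjMono p _ ⟩
    ∑ p (monoCoeff i j ∘ conjMono)                  ≈⟨ ∑-cong p (monoCoeff-conj i j) ⟩
    ∑ p (λ m → star (monoCoeff (ℤ.- i) (ℤ.- j) m))  ≈⟨ ∑-star p _ ⟨
    star (∑ p (monoCoeff (ℤ.- i) (ℤ.- j)))          ≈⟨ star-cong (coeff≈∑ p _ _) ⟨
    star (coeff p (ℤ.- i) (ℤ.- j))                  ∎

  ≋-refl : ∀ {p} → p ≋ p
  ≋-refl i j = refl

  ≋-sym : ∀ {p q} → p ≋ q → q ≋ p
  ≋-sym e i j = sym (e i j)

  ≋-trans : ∀ {p q s} → p ≋ q → q ≋ s → p ≋ s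
  ≋-trans e f i j = trans (e i j) (f i j)

  ⊕-cong : ∀ {p p′ q q′} → p ≋ p′ → q ≋ q′ → p ⊕ q ≋ p′ ⊕ q′
  ⊕-cong {p} {p′} {q} {q′} e f i j =
    trans (coeff-⊕ p q i j) (trans (+-cong (e i j) (f i j)) (sym (coeff-⊕ p′ q′ i j)))

  ⊕-assoc : ∀ p q s → (p ⊕ q) ⊕ s ≋ p ⊕ (q ⊕ s)
  ⊕-assoc p q s i j = begin
    coeff ((p ⊕ q) ⊕ s) i j                  ≈⟨ trans (coeff-⊕ (p ⊕ q) s i j) (+-congʳ (coeff-⊕ p q i j)) ⟩
    coeff p i j + coeff q i j + coeff s i j  ≈⟨ +-assoc _ _ _ ⟩
    coeff p i j + (coeff q i j + coeff s i j) ≈⟨ trans (coeff-⊕ p (q ⊕ s) i j) (+-congˡ (coeff-⊕ q s i j)) ⟨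
    coeff (p ⊕ (q ⊕ s)) i j                  ∎

  ⊕-comm : ∀ p q → p ⊕ q ≋ q ⊕ p
  ⊕-comm p q i j = trans (coeff-⊕ p q i j) (trans (+-comm _ _) (sym (coeff-⊕ q p i j)))

  ⊕-identityˡ : ∀ p → [] ⊕ p ≋ p
  ⊕-identityˡ p = ≋-refl {p}

  ⊕-identityʳ : ∀ p → p ⊕ [] ≋ p
  ⊕-identityʳ p i j = trans (coeff-⊕ p [] i j) (+-identityʳ _)

  negate-cong : ∀ {p q} → p ≋ q → negate p ≋ negate q
  negate-cong {p} {q} e i j =
    trans (coeff-negate p i j) (trans (-‿cong (e i j)) (sym (coeff-negate q i j)))

  negate-inverseˡ : ∀ p → negate p ⊕ p ≋ []
  negate-inverseˡ p i j =
    trans (coeff-⊕ (negate p) p i j) (trans (+-congʳ (coeff-negate p i j)) (-‿inverseˡ _))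

  negate-inverseʳ : ∀ p → p ⊕ negate p ≋ []
  negate-inverseʳ p i j =
    trans (coeff-⊕ p (negate p) i j) (trans (+-congˡ (coeff-negate p i j)) (-‿inverseʳ _))

  ⊗-comm : ∀ p q → p ⊗ q ≋ q ⊗ p
  ⊗-comm p q i j = begin
    coeff (p ⊗ q) i j                              ≈⟨ coeff-⊗ p q i j ⟩
    ∑ p (λ m → ∑ q (λ n → monoCoeff i j (m · n)))  ≈⟨ ∑-swap p q _ ⟩
    ∑ q (λ n → ∑ p (λ m → monoCoeff i j (m · n)))
      ≈⟨ ∑-cong q (λ n → ∑-cong p (λ m → monoCoeff-cong i j (·-comm m n))) ⟩
    ∑ q (λ n → ∑ p (λ m → monoCoeff i j (n · m)))  ≈⟨ coeff-⊗ q p i j ⟨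
    coeff (q ⊗ p) i j                              ∎

  ⊗-congʳ : ∀ p {q q′} → q ≋ q′ → p ⊗ q ≋ p ⊗ q′
  ⊗-congʳ p {q} {q′} e i j = begin
    coeff (p ⊗ q) i j    ≈⟨ coeff-⊗-shifted p q i j ⟩
    ∑ p (shifted q i j)  ≈⟨ ∑-cong p (λ { (c , k , l) → *-congˡ (e _ _) }) ⟩
    ∑ p (shifted q′ i j) ≈⟨ coeff-⊗-shifted p q′ i j ⟨
    coeff (p ⊗ q′) i j   ∎

  ⊗-cong : ∀ {p p′ q q′} → p ≋ p′ → q ≋ q′ → p ⊗ q ≋ p′ ⊗ q′
  ⊗-cong {p} {p′} {q} {q′} e f =
    ≋-trans {p ⊗ q} {p ⊗ q′} {p′ ⊗ q′} (⊗-congʳ p f)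
      (≋-trans {p ⊗ q′} {q′ ⊗ p} {p′ ⊗ q′} (⊗-comm p q′)
        (≋-trans {q′ ⊗ p} {q′ ⊗ p′} {p′ ⊗ q′} (⊗-congʳ q′ e) (⊗-comm q′ p′)))

  ⊗-assoc : ∀ p q s → (p ⊗ q) ⊗ s ≋ p ⊗ (q ⊗ s)
  ⊗-assoc p q s i j = begin
    coeff ((p ⊗ q) ⊗ s) i j
      ≈⟨ trans (coeff-⊗ (p ⊗ q) s i j) (trans (∑-concatMap _ p _) (∑-cong p (λ m → ∑-map _ q _))) ⟩
    ∑ p (λ m → ∑ q (λ n → ∑ s (λ o → monoCoeff i j ((m · n) · o))))
      ≈⟨ ∑-cong p (λ m → ∑-cong q (λ n → ∑-cong s (λ o → monoCoeff-cong i j (·-assoc m n o)))) ⟩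
    ∑ p (λ m → ∑ q (λ n → ∑ s (λ o → monoCoeff i j (m · (n · o)))))
      ≈⟨ trans (coeff-⊗ p (q ⊗ s) i j) (∑-cong p (λ m → trans (∑-concatMap _ q _) (∑-cong q (λ n → ∑-map _ s _)))) ⟨
    coeff (p ⊗ (q ⊗ s)) i j ∎

  ⊗-identityˡ : ∀ p → one ⊗ p ≋ p
  ⊗-identityˡ p i j = begin
    coeff (one ⊗ p) i j                                   ≈⟨ coeff-⊗ one p i j ⟩
    ∑ p (λ n → monoCoeff i j ((1# , + 0 , + 0) · n)) + 0#  ≈⟨ +-identityʳ _ ⟩
    ∑ p (λ n → monoCoeff i j ((1# , + 0 , + 0) · n))       ≈⟨ ∑-cong p (λ n → monoCoeff-cong i j (·-identityˡ n)) ⟩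
    ∑ p (monoCoeff i j)                                   ≈⟨ coeff≈∑ p i j ⟨
    coeff p i j                                           ∎

  ⊗-identityʳ : ∀ p → p ⊗ one ≋ p
  ⊗-identityʳ p = ≋-trans {p ⊗ one} {one ⊗ p} {p} (⊗-comm p one) (⊗-identityˡ p)

  ⊗-distribˡ : ∀ p q s → p ⊗ (q ⊕ s) ≋ p ⊗ q ⊕ p ⊗ s
  ⊗-distribˡ p q s i j = begin
    coeff (p ⊗ (q ⊕ s)) i j                    ≈⟨ coeff-⊗-shifted p (q ⊕ s) i j ⟩
    ∑ p (shifted (q ⊕ s) i j)
      ≈⟨ ∑-cong p (λ { (c , k , l) → trans (*-congˡ (coeff-⊕ q s _ _)) (distribˡ c _ _) }) ⟩
    ∑ p (λ m → shifted q i j m + shifted s i j m) ≈⟨ ∑-+ p _ _ ⟩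
    ∑ p (shifted q i j) + ∑ p (shifted s i j)
      ≈⟨ +-cong (coeff-⊗-shifted p q i j) (coeff-⊗-shifted p s i j) ⟨
    coeff (p ⊗ q) i j + coeff (p ⊗ s) i j      ≈⟨ coeff-⊕ (p ⊗ q) (p ⊗ s) i j ⟨
    coeff (p ⊗ q ⊕ p ⊗ s) i j                  ∎

  ⊗-distribʳ : ∀ p q s → (q ⊕ s) ⊗ p ≋ q ⊗ p ⊕ s ⊗ p
  ⊗-distribʳ p q s =
    ≋-trans {(q ⊕ s) ⊗ p} {p ⊗ (q ⊕ s)} {q ⊗ p ⊕ s ⊗ p} (⊗-comm (q ⊕ s) p)
      (≋-trans {p ⊗ (q ⊕ s)} {p ⊗ q ⊕ p ⊗ s} {q ⊗ p ⊕ s ⊗ p} (⊗-distribˡ p q s)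
        (⊕-cong {p ⊗ q} {q ⊗ p} {p ⊗ s} {s ⊗ p} (⊗-comm p q) (⊗-comm p s)))

  -- p ≋ q unfolds to a function type, from which Agda cannot recover p and q;
  -- the ring bundle needs a relation whose indices are inferable, hence this wrapper.
  infix 4 _≈ᴸ_

  record _≈ᴸ_ (p q : Poly) : Set ℓ where
    constructor coeffwise
    field coeffwise-eq : p ≋ q
  open _≈ᴸ_ public

  laurentRing : CommutativeRing r ℓ
  laurentRing = record
    { Carrier = Poly ; _≈_ = _≈ᴸ_ ; _+_ = _⊕_ ; _*_ = _⊗_ ; -_ = negate ; 0# = [] ; 1# = one
    ; isCommutativeRing = record
      { isRing = record
        { +-isAbelianGroup = record
          { isGroup = record
            { isMonoid = record
              { isSemigroup = record
                { isMagma = record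
                  { isEquivalence = record
                    { refl = λ {p} → coeffwise (≋-refl {p})
                    ; sym = λ {p} {q} e → coeffwise (≋-sym {p} {q} (coeffwise-eq e))
                    ; trans = λ {p} {q} {s} e f →
                        coeffwise (≋-trans {p} {q} {s} (coeffwise-eq e) (coeffwise-eq f)) }
                  ; ∙-cong = λ {p} {p′} {q} {q′} e f →
                      coeffwise (⊕-cong {p} {p′} {q} {q′} (coeffwise-eq e) (coeffwise-eq f)) }
                ; assoc = λ p q s → coeffwise (⊕-assoc p q s) }
              ; identity = (λ p → coeffwise (⊕-identityˡ p)) , (λ p → coeffwise (⊕-identityʳ p)) }
            ; inverse = (λ p → coeffwise (negate-inverseˡ p)) , (λ p → coeffwise (negate-inverseʳ p))
            ; ⁻¹-cong = λ {p} {q} e → coeffwise (negate-cong {p} {q} (coeffwise-eq e)) }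
          ; comm = λ p q → coeffwise (⊕-comm p q) }
        ; *-cong = λ {p} {p′} {q} {q′} e f →
            coeffwise (⊗-cong {p} {p′} {q} {q′} (coeffwise-eq e) (coeffwise-eq f))
        ; *-assoc = λ p q s → coeffwise (⊗-assoc p q s)
        ; *-identity = (λ p → coeffwise (⊗-identityˡ p)) , (λ p → coeffwise (⊗-identityʳ p))
        ; distrib = (λ p q s → coeffwise (⊗-distribˡ p q s)) , (λ p q s → coeffwise (⊗-distribʳ p q s)) }
      ; *-comm = λ p q → coeffwise (⊗-comm p q) } }

  conj-cong : ∀ {p q} → p ≋ q → conj p ≋ conj q
  conj-cong {p} {q} e i j = trans (coeff-conj p i j) (trans (star-cong (e _ _)) (sym (coeff-conj q i j)))

  conj-⊕ : ∀ p q → conj (p ⊕ q) ≋ conj p ⊕ conj q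
  conj-⊕ p q i j = begin
    coeff (conj (p ⊕ q)) i j                       ≈⟨ coeff-conj (p ⊕ q) i j ⟩
    star (coeff (p ⊕ q) (ℤ.- i) (ℤ.- j))           ≈⟨ trans (star-cong (coeff-⊕ p q _ _)) (star-+ _ _) ⟩
    star (coeff p (ℤ.- i) (ℤ.- j)) + star (coeff q (ℤ.- i) (ℤ.- j))
      ≈⟨ trans (coeff-⊕ (conj p) (conj q) i j) (+-cong (coeff-conj p i j) (coeff-conj q i j)) ⟨
    coeff (conj p ⊕ conj q) i j                    ∎

  conj-⊗ : ∀ p q → conj (p ⊗ q) ≋ conj p ⊗ conj q
  conj-⊗ p q i j = begin
    coeff (conj (p ⊗ q)) i j
      ≈⟨ trans (coeff-conj (p ⊗ q) i j) (star-cong (coeff-⊗ p q _ _)) ⟩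
    star (∑ p (λ m → ∑ q (λ n → monoCoeff (ℤ.- i) (ℤ.- j) (m · n))))
      ≈⟨ trans (∑-star p _) (∑-cong p (λ m → ∑-star q _)) ⟩
    ∑ p (λ m → ∑ q (λ n → star (monoCoeff (ℤ.- i) (ℤ.- j) (m · n))))
      ≈⟨ ∑-cong p (λ m → ∑-cong q (λ n →
           trans (sym (monoCoeff-conj i j (m · n))) (monoCoeff-cong i j (∼-sym (conj-· m n))))) ⟩
    ∑ p (λ m → ∑ q (λ n → monoCoeff i j (conjMono m · conjMono n)))
      ≈⟨ trans (coeff-⊗ (conj p) (conj q) i j) (trans (∑-map conjMono p _) (∑-cong p (λ m → ∑-map conjMono q _))) ⟨
    coeff (conj p ⊗ conj q) i j ∎

  conj-one : conj one ≋ one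
  conj-one i j =
    trans (coeff≈∑ (conj one) i j) (trans (+-congʳ (select-cong _ star-1)) (sym (coeff≈∑ one i j)))

  conj-conj : ∀ p → conj (conj p) ≋ p
  conj-conj p i j = begin
    coeff (conj (conj p)) i j
      ≈⟨ trans (coeff-conj (conj p) i j) (star-cong (coeff-conj p _ _)) ⟩
    star (star (coeff p (ℤ.- (ℤ.- i)) (ℤ.- (ℤ.- j))))
      ≈⟨ star-inv _ ⟩
    coeff p (ℤ.- (ℤ.- i)) (ℤ.- (ℤ.- j))
      ≡⟨ ≡.cong₂ (coeff p) (ℤP.neg-involutive i) (ℤP.neg-involutive j) ⟩
    coeff p i j ∎

  conjInvolution : Involution laurentRing
  conjInvolution = record
    { star = conj
    ; star-cong = λ {p} {q} e → coeffwise (conj-cong {p} {q} (coeffwise-eq e))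
    ; star-+ = λ p q → coeffwise (conj-⊕ p q)
    ; star-* = λ p q → coeffwise (conj-⊗ p q)
    ; star-1 = coeffwise conj-one
    ; star-inv = λ p → coeffwise (conj-conj p) }

module Encodings {r ℓ} (R : CommutativeRing r ℓ) (ι : Involution R) where
  open CommutativeRing R
  open Involution ι
  open Laurent R ι
  open LaurentRing R ι
  open import Relation.Binary.Reasoning.Setoid setoid

  ex-opposite : ∀ k (i : Fin k) → ex k (opposite i) ≡ ℤ.- ex k i
  ex-opposite k i =
    reflect-about (+ (2 ℕ.* toℕ (opposite i) ℕ.+ 1)) (+ (2 ℕ.* toℕ i ℕ.+ 1)) (+ k) (≡.cong +_ exponents-sum)
    where
    t s : ℕ
    t = toℕ i
    s = k ℕ.∸ ℕ.suc t
    exponents-sum : (2 ℕ.* toℕ (opposite i) ℕ.+ 1) ℕ.+ (2 ℕ.* t ℕ.+ 1) ≡ k ℕ.+ k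
    exponents-sum = ≡.trans (≡.cong (λ o → (2 ℕ.* o ℕ.+ 1) ℕ.+ (2 ℕ.* t ℕ.+ 1)) (FinP.opposite-prop i))
                     (≡.trans (arith s t) (≡.cong₂ ℕ._+_ k≡ k≡))
      where
      k≡ : ℕ.suc t ℕ.+ s ≡ k
      k≡ = NatP.m+[n∸m]≡n (FinP.toℕ<n i)
      arith : ∀ s t → (2 ℕ.* s ℕ.+ 1) ℕ.+ (2 ℕ.* t ℕ.+ 1) ≡ (ℕ.suc t ℕ.+ s) ℕ.+ (ℕ.suc t ℕ.+ s)
      arith = NatSolver.solve-∀

  ψ-along : (Carrier → ℤ → Monomial) → ∀ {k} → Seq k → Poly
  ψ-along place {k} s = List.map (λ i → place (Vec.lookup s i) (ex k i)) (allFin k)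

  ψ-along-reverse : (place : Carrier → ℤ → Monomial) →
    (∀ c e → conjMono (place c e) ≡ place (star c) (ℤ.- e)) →
    ∀ {k} (s : Seq k) → ψ-along place (s ˢ*) ≋ conj (ψ-along place s)
  ψ-along-reverse place place-conj {k} s i₀ j₀ = begin
    coeff (ψ-along place (s ˢ*)) i₀ j₀
      ≈⟨ trans (coeff≈∑ (ψ-along place (s ˢ*)) i₀ j₀) (∑-map _ (allFin k) _) ⟩
    ∑ (allFin k) (λ i → monoCoeff i₀ j₀ (place (Vec.lookup (s ˢ*) i) (ex k i)))
      ≈⟨ ∑-cong (allFin k) (λ i → reflexive (≡.cong (monoCoeff i₀ j₀) (≡.cong₂ place (reversed-entry i) (reversed-exponent i)))) ⟩
    ∑ (allFin k) (conjugated ∘ opposite)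
      ≈⟨ ∑-opposite k conjugated ⟩
    ∑ (allFin k) conjugated
      ≈⟨ ∑-cong (allFin k) (λ i → reflexive (≡.cong (monoCoeff i₀ j₀) (≡.sym (place-conj (Vec.lookup s i) (ex k i))))) ⟩
    ∑ (allFin k) (λ i → monoCoeff i₀ j₀ (conjMono (place (Vec.lookup s i) (ex k i))))
      ≈⟨ trans (coeff≈∑ (conj (ψ-along place s)) i₀ j₀) (trans (∑-map conjMono (ψ-along place s) _) (∑-map _ (allFin k) _)) ⟨
    coeff (conj (ψ-along place s)) i₀ j₀ ∎
    where
    conjugated : Fin k → Carrier
    conjugated i = monoCoeff i₀ j₀ (place (star (Vec.lookup s i)) (ℤ.- ex k i))
    reversed-entry : ∀ i → Vec.lookup (s ˢ*) i ≡ star (Vec.lookup s (opposite i))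
    reversed-entry i = ≡.trans (lookup-reverse (Vec.map star s) i) (VecP.lookup-map (opposite i) star s)
    reversed-exponent : ∀ i → ex k i ≡ ℤ.- ex k (opposite i)
    reversed-exponent i = ≡.trans (≡.cong (ex k) (≡.sym (FinP.opposite-involutive i))) (ex-opposite k (opposite i))

  ψx-reverse : ∀ {k} (s : Seq k) → ψx (s ˢ*) ≋ conj (ψx s)
  ψx-reverse = ψ-along-reverse (λ c e → (c , e , + 0)) (λ c e → ≡.refl)

  ψy-reverse : ∀ {k} (s : Seq k) → ψy (s ˢ*) ≋ conj (ψy s)
  ψy-reverse = ψ-along-reverse (λ c e → (c , + 0 , e)) (λ c e → ≡.refl)

  ∑∑ : ∀ {m n} → (Fin m → Fin n → Carrier) → Carrier
  ∑∑ {m} {n} F = ∑ (allFin m) (λ i → ∑ (allFin n) (F i))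

  ∑∑-cong : ∀ {m n} {F G : Fin m → Fin n → Carrier} → (∀ i j → F i j ≈ G i j) → ∑∑ F ≈ ∑∑ G
  ∑∑-cong {m} {n} e = ∑-cong (allFin m) (λ i → ∑-cong (allFin n) (e i))

  ∑∑-+ : ∀ {m n} (F G : Fin m → Fin n → Carrier) → ∑∑ (λ i j → F i j + G i j) ≈ ∑∑ F + ∑∑ G
  ∑∑-+ {m} {n} F G = trans (∑-cong (allFin m) (λ i → ∑-+ (allFin n) (F i) (G i))) (∑-+ (allFin m) _ _)

  ∑∑-neg : ∀ {m n} (F : Fin m → Fin n → Carrier) → ∑∑ (λ i j → - F i j) ≈ - ∑∑ F
  ∑∑-neg {m} {n} F = trans (∑-cong (allFin m) (λ i → ∑-neg (allFin n) (F i))) (∑-neg (allFin m) _)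

  entry : ∀ {m n} → Mat m n → Fin m → Fin n → Carrier
  entry A i j = Vec.lookup (Vec.lookup A i) j

  entry-zipWith : ∀ {m n} (_∙_ : Carrier → Carrier → Carrier) (A B : Mat m n) i j →
                  entry (Vec.zipWith (Vec.zipWith _∙_) A B) i j ≡ entry A i j ∙ entry B i j
  entry-zipWith _∙_ A B i j =
    ≡.trans (≡.cong (λ row → Vec.lookup row j) (VecP.lookup-zipWith (Vec.zipWith _∙_) i A B))
            (VecP.lookup-zipWith _∙_ j (Vec.lookup A i) (Vec.lookup B i))

  entryCoeff : ∀ {m n} → Mat m n → ℤ → ℤ → Fin m → Fin n → Carrier
  entryCoeff {m} {n} A i₀ j₀ i j = monoCoeff i₀ j₀ (entry A i j , ex n j , ex m i)

  coeff-ψM : ∀ {m n} (A : Mat m n) i₀ j₀ → coeff (ψM A) i₀ j₀ ≈ ∑∑ (entryCoeff A i₀ j₀)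
  coeff-ψM {m} {n} A i₀ j₀ =
    trans (coeff≈∑ (ψM A) i₀ j₀) (trans (∑-concatMap _ (allFin m) _) (∑-cong (allFin m) (λ i → ∑-map _ (allFin n) _)))

  ψM-⊞ : ∀ {m n} (A B : Mat m n) → ψM (A ⊞ B) ≋ ψM A ⊕ ψM B
  ψM-⊞ A B i₀ j₀ = begin
    coeff (ψM (A ⊞ B)) i₀ j₀                ≈⟨ coeff-ψM (A ⊞ B) i₀ j₀ ⟩
    ∑∑ (entryCoeff (A ⊞ B) i₀ j₀)
      ≈⟨ ∑∑-cong (λ i j → trans (select-cong _ (reflexive (entry-zipWith _+_ A B i j))) (select-+ _ _ _)) ⟩
    ∑∑ (λ i j → entryCoeff A i₀ j₀ i j + entryCoeff B i₀ j₀ i j) ≈⟨ ∑∑-+ (entryCoeff A i₀ j₀) (entryCoeff B i₀ j₀) ⟩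
    ∑∑ (entryCoeff A i₀ j₀) + ∑∑ (entryCoeff B i₀ j₀)
      ≈⟨ trans (coeff-⊕ (ψM A) (ψM B) i₀ j₀) (+-cong (coeff-ψM A i₀ j₀) (coeff-ψM B i₀ j₀)) ⟨
    coeff (ψM A ⊕ ψM B) i₀ j₀               ∎

  ψM-⊟ : ∀ {m n} (A B : Mat m n) → ψM (A ⊟ B) ≋ ψM A ⊕ negate (ψM B)
  ψM-⊟ A B i₀ j₀ = begin
    coeff (ψM (A ⊟ B)) i₀ j₀                ≈⟨ coeff-ψM (A ⊟ B) i₀ j₀ ⟩
    ∑∑ (entryCoeff (A ⊟ B) i₀ j₀)
      ≈⟨ ∑∑-cong (λ i j → trans (select-cong _ (reflexive (entry-zipWith _-_ A B i j)))
                                (trans (select-+ _ _ _) (+-congˡ (select-neg _ _)))) ⟩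
    ∑∑ (λ i j → entryCoeff A i₀ j₀ i j + - entryCoeff B i₀ j₀ i j)
      ≈⟨ trans (∑∑-+ (entryCoeff A i₀ j₀) _) (+-congˡ (∑∑-neg (entryCoeff B i₀ j₀))) ⟩
    ∑∑ (entryCoeff A i₀ j₀) - ∑∑ (entryCoeff B i₀ j₀)
      ≈⟨ trans (coeff-⊕ (ψM A) (negate (ψM B)) i₀ j₀)
               (+-cong (coeff-ψM A i₀ j₀) (trans (coeff-negate (ψM B) i₀ j₀) (-‿cong (coeff-ψM B i₀ j₀)))) ⟨
    coeff (ψM A ⊕ negate (ψM B)) i₀ j₀      ∎

  ψM-outer : ∀ {m n} (u : Seq m) (v : Seq n) → ψM (outer u v) ≋ ψy u ⊗ ψx v
  ψM-outer {m} {n} u v i₀ j₀ = begin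
    coeff (ψM (outer u v)) i₀ j₀ ≈⟨ coeff-ψM (outer u v) i₀ j₀ ⟩
    ∑∑ (entryCoeff (outer u v) i₀ j₀)
      ≈⟨ ∑∑-cong (λ i j → monoCoeff-cong i₀ j₀ (entry-outer i j)) ⟩
    ∑∑ (λ i j → monoCoeff i₀ j₀ ((Vec.lookup u i , + 0 , ex m i) · (Vec.lookup v j , ex n j , + 0)))
      ≈⟨ trans (coeff-⊗ (ψy u) (ψx v) i₀ j₀) (trans (∑-map _ (allFin m) _) (∑-cong (allFin m) (λ i → ∑-map _ (allFin n) _))) ⟨
    coeff (ψy u ⊗ ψx v) i₀ j₀ ∎
    where
    entry-outer : ∀ i j → (entry (outer u v) i j , ex n j , ex m i)
                          ∼ (Vec.lookup u i , + 0 , ex m i) · (Vec.lookup v j , ex n j , + 0)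
    entry-outer i j =
      reflexive (≡.trans (≡.cong (λ row → Vec.lookup row j) (VecP.lookup-map i _ u)) (VecP.lookup-map j _ v))
      , ≡.sym (ℤP.+-identityˡ (ex n j)) , ≡.sym (ℤP.+-identityʳ (ex m i))

  -- "ψ_A equals p in the Laurent ring", as a record so that A can be inferred
  -- when these facts are combined along the structure of a matrix expression.
  infix 4 _↦_

  record _↦_ {m n} (A : Mat m n) (p : Poly) : Set ℓ where
    constructor image
    field image-eq : ψM A ≈ᴸ p
  open _↦_ public

  module _ {m n : ℕ} where
    private module L = CommutativeRing laurentRing

    infixl 6 _⊞ᴸ_ _⊟ᴸ_

    _⊞ᴸ_ : ∀ {A B : Mat m n} {p q} → A ↦ p → B ↦ q → A ⊞ B ↦ p ⊕ q
    _⊞ᴸ_ {A} {B} (image eA) (image eB) = image (L.trans (coeffwise (ψM-⊞ A B)) (L.+-cong eA eB))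

    _⊟ᴸ_ : ∀ {A B : Mat m n} {p q} → A ↦ p → B ↦ q → A ⊟ B ↦ p ⊕ negate q
    _⊟ᴸ_ {A} {B} (image eA) (image eB) = image (L.trans (coeffwise (ψM-⊟ A B)) (L.+-cong eA (L.-‿cong eB)))

    ψ-outer : ∀ (u : Seq m) (v : Seq n) → outer u v ↦ ψy u ⊗ ψx v
    ψ-outer u v = image (coeffwise (ψM-outer u v))

    ψ-outer-starˡ : ∀ (u : Seq m) (v : Seq n) → outer (u ˢ*) v ↦ conj (ψy u) ⊗ ψx v
    ψ-outer-starˡ u v =
      image (L.trans (image-eq (ψ-outer (u ˢ*) v)) (L.*-congʳ (coeffwise {ψy (u ˢ*)} {conj (ψy u)} (ψy-reverse u))))

    ψ-outer-starʳ : ∀ (u : Seq m) (v : Seq n) → outer u (v ˢ*) ↦ ψy u ⊗ conj (ψx v)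
    ψ-outer-starʳ u v =
      image (L.trans (image-eq (ψ-outer u (v ˢ*))) (L.*-cong (L.refl {ψy u}) (coeffwise {ψx (v ˢ*)} {conj (ψx v)} (ψx-reverse v))))

lemma3p1 : ∀ {r ℓ} (R : CommutativeRing r ℓ) (ι : Involution R) {n m : ℕ}
  (a b c d : Vec (CommutativeRing.Carrier R) n)
  (e f g h : Vec (CommutativeRing.Carrier R) m) →
  let open Laurent R ι
      Q = outer (f ˢ*) a ⊞ outer g c ⊟ outer e (b ˢ*) ⊞ outer h d
      R′ = outer (f ˢ*) b ⊞ outer (g ˢ*) d ⊞ outer e (a ˢ*) ⊟ outer (h ˢ*) c
      S = outer (g ˢ*) a ⊟ outer f c ⊟ outer h b ⊟ outer e (d ˢ*)
      T = outer g b ⊟ outer f d ⊞ outer (h ˢ*) a ⊞ outer e (c ˢ*)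
  in ψM Q ⊗ conj (ψM Q) ⊕ ψM R′ ⊗ conj (ψM R′) ⊕ ψM S ⊗ conj (ψM S) ⊕ ψM T ⊗ conj (ψM T)
     ≋ (ψx a ⊗ conj (ψx a) ⊕ ψx b ⊗ conj (ψx b) ⊕ ψx c ⊗ conj (ψx c) ⊕ ψx d ⊗ conj (ψx d))
       ⊗ (ψy e ⊗ conj (ψy e) ⊕ ψy f ⊗ conj (ψy f) ⊕ ψy g ⊗ conj (ψy g) ⊕ ψy h ⊗ conj (ψy h))
-- Writing A = ψ_a(x), …, E = ψ_e(y), …, each of ψ_Q, ψ_R, ψ_S, ψ_T is computed from the
-- structure of its matrix, and norm-identity in the Laurent ring finishes the proof.
lemma3p1 R ι a b c d e f g h = coeffwise-eq (trans
  (+-cong (+-cong (+-cong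
    (norm-cong (ψ-outer-starˡ f a ⊞ᴸ ψ-outer g c ⊟ᴸ ψ-outer-starʳ e b ⊞ᴸ ψ-outer h d))
    (norm-cong (ψ-outer-starˡ f b ⊞ᴸ ψ-outer-starˡ g d ⊞ᴸ ψ-outer-starʳ e a ⊟ᴸ ψ-outer-starˡ h c)))
    (norm-cong (ψ-outer-starˡ g a ⊟ᴸ ψ-outer f c ⊟ᴸ ψ-outer h b ⊟ᴸ ψ-outer-starʳ e d)))
    (norm-cong (ψ-outer g b ⊟ᴸ ψ-outer f d ⊞ᴸ ψ-outer-starˡ h a ⊞ᴸ ψ-outer-starʳ e c)))
  (norm-identity (ψx a) (ψx b) (ψx c) (ψx d) (ψy e) (ψy f) (ψy g) (ψy h)))
  where
  open Laurent R ι using (Mat; ψM; ψx; ψy)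
  open LaurentRing R ι using (laurentRing; conjInvolution; coeffwise-eq)
  open Encodings R ι using (_↦_; image; _⊞ᴸ_; _⊟ᴸ_; ψ-outer; ψ-outer-starˡ; ψ-outer-starʳ)
  open CommutativeRing laurentRing using (_≈_; _*_; trans; +-cong; *-cong)
  open Involution conjInvolution using (star; star-cong)
  open NormIdentity laurentRing conjInvolution using (norm-identity)
  norm-cong : ∀ {m n} {A : Mat m n} {p} → A ↦ p → ψM A * star (ψM A) ≈ p * star p
  norm-cong (image e) = *-cong e (star-cong e)
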